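{- Let $T$ be a finite tree with center $C = C(T)$, let $S_i$ be a component of $T - C$, and let $v_i \in V(S_i)$ be the vertex of $S_i$ adjacent to a vertex $u \in C$. Then for every positive integer $k$, $D(S_i;k) = D(S'_i;k)$.
   Context: The center $C(T)$ of a tree is the set of vertices of minimum eccentricity (one vertex or the two endpoints of an edge). Define $T_0 = T$, $T_{i+1} = T_i$ minus its leaves; for a vertex $v \in V(T)$ that is a leaf of some $T_j$ having at least one edge, $e_v$ is the unique edge of $T_j$ incident to $v$. $L(T)$ is the line graph of $T$. $S'_i$ is the subgraph of $L(T)$ induced by $\{e_v : v \in V(S_i)\}$ (this consists of the edges of $S_i$ together with the edge $e_{v_i}$ joining $v_i$ to $C$). Let $A_i$ be the group of automorphisms of $S_i$ fixing $v_i$, and $A'_i$ the group of automorphisms of $S'_i$ fixing $e_{v_i}$. A $k$-coloring $f: V(S_i)\to\{1,\dots,k\}$ distinguishes $S_i$ with respect to $A_i$ if every non-identity $\phi\in A_i$ has a vertex $v$ with $f(v)\neq f(\phi(v))$. Two such colorings $f_1,f_2$ are equivalent if there is $\phi \in A_i$ with $f_1(v) = f_2(\phi(v))$ for all $v$. $D(S_i;k)$ is the number of equivalence classes of $k$-colorings of $S_i$ that distinguish $S_i$ with respect to $A_i$. $D(S'_i;k)$ is defined in the same way using $S'_i$ and $A'_i$. -}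

module Defs where

open import Data.Nat using (ℕ; zero; suc; _≤_; _<_)
open import Data.Fin using (Fin; toℕ)
open import Data.Bool using (Bool; true)
open import Data.List using (List; []; _∷_; length)
open import Data.List.Relation.Unary.All using (All)
open import Data.List.Relation.Unary.Unique.Propositional using (Unique)
open import Data.Product using (Σ; ∃; _×_; _,_)
open import Data.Sum using (_⊎_)
open import Data.Unit using (⊤)
open import Relation.Nullary using (¬_)
open import Relation.Binary.PropositionalEquality using (_≡_)

-- Generic notions for an induced subgraph of a graph on a base type B:
-- the vertex set is a predicate P on B, adjacency is a relation R on B
-- (restricted to P).  Colourings are maps B → Fin k; only their values
-- on P matter (two colourings agreeing on P are equivalent, since the
-- identity is an automorphism).

module _ {B : Set} (P : B → Set) (R : B → B → Set) where

  IsAut : (B → B) → Set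
  IsAut φ =
    (∀ x → P x → P (φ x)) ×
    (Σ (B → B) λ ψ →
        (∀ x → P x → P (ψ x)) ×
        (∀ x → P x → ψ (φ x) ≡ x) ×
        (∀ x → P x → φ (ψ x) ≡ x)) ×
    (∀ x y → P x → P y → (R x y → R (φ x) (φ y)) × (R (φ x) (φ y) → R x y))

  IsRootedAut : B → (B → B) → Set
  IsRootedAut r φ = IsAut φ × φ r ≡ r

  Distinguishes : (r : B) (k : ℕ) → (B → Fin k) → Set
  Distinguishes r k f =
    ∀ φ → IsRootedAut r φ → (∀ x → P x → f x ≡ f (φ x)) → ∀ x → P x → φ x ≡ x

  DistColoring : B → ℕ → Set
  DistColoring r k = Σ (B → Fin k) (Distinguishes r k)

  EquivCol : (r : B) (k : ℕ) → DistColoring r k → DistColoring r k → Set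
  EquivCol r k (f₁ , _) (f₂ , _) =
    Σ (B → B) λ φ → IsRootedAut r φ × (∀ x → P x → f₁ x ≡ f₂ (φ x))

-- Two types carrying equivalence relations have the same number of
-- equivalence classes: there is a bijection between the quotients,
-- given by maps respecting the relations that are mutually inverse
-- up to the relations.
SameNumberOfClasses : (X : Set) → (X → X → Set) → (Y : Set) → (Y → Y → Set) → Set
SameNumberOfClasses X _~_ Y _≈_ =
  Σ (X → Y) λ F → Σ (Y → X) λ G →
    (∀ a b → a ~ b → F a ≈ F b) ×
    (∀ c d → c ≈ d → G c ~ G d) ×
    (∀ a → G (F a) ~ a) ×
    (∀ c → F (G c) ≈ c)

module Graph {n : ℕ} (adj : Fin n → Fin n → Bool) where

  Adj : Fin n → Fin n → Set
  Adj x y = adj x y ≡ true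

  data Walk : Fin n → Fin n → Set where
    nil  : ∀ v → Walk v v
    cons : ∀ u {w v} → Adj u w → Walk w v → Walk u v

  len : ∀ {u v} → Walk u v → ℕ
  len (nil _) = 0
  len (cons _ _ p) = suc (len p)

  verts : ∀ {u v} → Walk u v → List (Fin n)
  verts (nil v) = v ∷ []
  verts (cons u _ p) = u ∷ verts p

  IsPath : ∀ {u v} → Walk u v → Set
  IsPath p = Unique (verts p)

  IsTree : Set
  IsTree =
    0 < n ×
    (∀ x y → Adj x y → Adj y x) ×
    (∀ x → ¬ Adj x x) ×
    (∀ u v → Σ (Walk u v) IsPath) ×
    (∀ u v (p q : Walk u v) → IsPath p → IsPath q → verts p ≡ verts q)

  IsDist : Fin n → Fin n → ℕ → Set
  IsDist u v d = (Σ (Walk u v) λ p → len p ≡ d) × (∀ (p : Walk u v) → d ≤ len p)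

  IsEcc : Fin n → ℕ → Set
  IsEcc v e = (∀ u d → IsDist v u d → d ≤ e) × (Σ (Fin n) λ u → IsDist v u e)

  InCenter : Fin n → Set
  InCenter v = Σ ℕ λ e → IsEcc v e × (∀ w e' → IsEcc w e' → e ≤ e')

  -- the component of T - C containing s (s ∉ C): vertices reachable
  -- from s by a walk avoiding C
  InComp : Fin n → Fin n → Set
  InComp s y = Σ (Walk s y) λ p → All (λ z → ¬ InCenter z) (verts p)

  mutual
    InT : ℕ → Fin n → Set
    InT zero v = ⊤
    InT (suc j) v = InT j v × ¬ IsLeafOf j v

    IsLeafOf : ℕ → Fin n → Set
    IsLeafOf j v =
      InT j v ×
      (Σ (Fin n) λ w → Adj v w × InT j w × (∀ w' → Adj v w' → InT j w' → w' ≡ w))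

  -- edges are represented as ordered pairs (x , y) with toℕ x < toℕ y
  Edge : Set
  Edge = Fin n × Fin n

  IsPair : Fin n → Fin n → Edge → Set
  IsPair v w (x , y) = toℕ x < toℕ y × ((x ≡ v × y ≡ w) ⊎ (x ≡ w × y ≡ v))

  -- e = e_v : v is a leaf of some T_j and e is the unique edge of T_j at v
  IsEv : Fin n → Edge → Set
  IsEv v e = Σ ℕ λ j → IsLeafOf j v × Σ (Fin n) λ w → Adj v w × InT j w × IsPair v w e

  LAdj : Edge → Edge → Set
  LAdj (x , y) (x' , y') =
    ¬ ((x , y) ≡ (x' , y')) × (x ≡ x' ⊎ x ≡ y' ⊎ y ≡ x' ⊎ y ≡ y')

  -- vertex set of S'_i : { e_v : v ∈ V(S_i) }
  InComp' : Fin n → Edge → Set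
  InComp' s e = Σ (Fin n) λ v → InComp s v × IsEv v e

-- Root T at the central vertex u, and let h(v) be the height of the subtree below v. Centrality of u
-- forces a second branch at u of height at least h(vᵢ) − 1, so u survives the leaf stripping long enough
-- that every v ∈ S_i is a leaf of T_{h(v)} whose remaining neighbour is its parent: e_v = {v, parent v}.
-- Hence v ↦ e_v is a bijection from S_i onto S'_i sending vᵢ to e_{vᵢ}, and e_v, e_w are adjacent in
-- L(T) iff v, w are adjacent or siblings. A bijection of S_i fixing vᵢ preserves adjacency iff it commutes
-- with the parent map iff it preserves "adjacent or siblings" (induction on depth), so conjugation by
-- v ↦ e_v identifies A_i with A'_i, and pulling colourings back along it matches distinguishing
-- colourings and their equivalence classes.
module Submission where

open import Defs
open import Data.Nat using (ℕ; zero; suc; _<_; _≤_; _+_; _∸_; z≤n; s≤s)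
open import Data.Nat.Properties
open import Data.Fin using (Fin; toℕ)
open import Data.Fin.Properties using (toℕ-injective; any?) renaming (_≟_ to _≟ᶠ_)
open import Data.Bool using (Bool; true)
open import Data.Bool.Properties using () renaming (_≟_ to _≟ᵇ_)
open import Data.List using (List; []; _∷_; _++_; _∷ʳ_; [_]; length; allFin; initLast; _∷ʳ′_)
open import Data.List.Properties using (++-assoc; length-++; ∷-injectiveˡ; ∷-injectiveʳ; ∷ʳ-injectiveˡ)
open import Data.List.Extrema.Nat using (argmax; v≤f[argmax]⁺)
open import Data.List.Relation.Unary.All as All using (All; []; _∷_)
open import Data.List.Relation.Unary.All.Properties using (¬Any⇒All¬; All¬⇒¬Any)
open import Data.List.Relation.Unary.Any using (here; there)
import Data.List.Relation.Unary.Any as Any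
open import Data.List.Relation.Unary.AllPairs using ([]; _∷_)
open import Data.List.Relation.Unary.Unique.Propositional using (Unique)
open import Data.List.Relation.Unary.Unique.Propositional.Properties using (++⁺)
open import Data.List.Relation.Binary.Subset.Propositional using (_⊆_)
open import Data.List.Membership.Propositional using (_∈_; _∉_)
open import Data.List.Membership.Propositional.Properties using (∈-++⁺ˡ; ∈-++⁺ʳ; ∈-++⁻; ∈-allFin)
open import Data.Product using (Σ; ∃; _×_; _,_; proj₁; proj₂; swap)
open import Data.Sum using (_⊎_; inj₁; inj₂; [_,_]′) renaming (map to ⊎-map; map₁ to ⊎-map₁; swap to ⊎-swap)
open import Data.Empty
open import Data.Unit using (tt)
open import Function using (_∘_; id)
open import Relation.Nullary
open import Relation.Nullary.Decidable using (_×-dec_; ¬?)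
open import Relation.Binary.PropositionalEquality hiding ([_])
open import Relation.Binary.Definitions using (tri<; tri≈; tri>)

module _ {A : Set} where

  Unique-++⁻ʳ : ∀ (xs : List A) {ys} → Unique (xs ++ ys) → Unique ys
  Unique-++⁻ʳ [] u = u
  Unique-++⁻ʳ (x ∷ xs) (_ ∷ u) = Unique-++⁻ʳ xs u

  Unique-++⇒∉ : ∀ (xs : List A) {ys x} → Unique (xs ++ ys) → x ∈ xs → x ∉ ys
  Unique-++⇒∉ (x ∷ xs) (x≢ ∷ _) (here refl) x∈ys = All¬⇒¬Any x≢ (∈-++⁺ʳ xs x∈ys)
  Unique-++⇒∉ (x ∷ xs) (_ ∷ u) (there x∈xs) = Unique-++⇒∉ xs u x∈xs

  Unique-∷ʳ : ∀ {xs} {x : A} → Unique xs → x ∉ xs → Unique (xs ∷ʳ x)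
  Unique-∷ʳ u x∉xs = ++⁺ u ([] ∷ []) λ { (x∈xs , here refl) → x∉xs x∈xs }

  Unique-suffix : ∀ (xs ys : List A) {c X Y} → Unique (xs ++ c ∷ X) →
                  xs ++ c ∷ X ≡ ys ++ c ∷ Y → X ≡ Y
  Unique-suffix [] [] u eq = ∷-injectiveʳ eq
  Unique-suffix [] (y ∷ ys) (c≢ ∷ _) refl = ⊥-elim (All¬⇒¬Any c≢ (∈-++⁺ʳ ys (here refl)))
  Unique-suffix (x ∷ xs) [] (c≢ ∷ _) refl = ⊥-elim (All¬⇒¬Any c≢ (∈-++⁺ʳ xs (here refl)))
  Unique-suffix (x ∷ xs) (y ∷ ys) (_ ∷ u) eq = Unique-suffix xs ys u (∷-injectiveʳ eq)

module _ {n : ℕ} where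

  argmaxFin : (Fin n → ℕ) → Fin n → Fin n
  argmaxFin f i = argmax f i (allFin n)

  ≤-argmaxFin : ∀ f i j → f j ≤ f (argmaxFin f i)
  ≤-argmaxFin f i j = v≤f[argmax]⁺ {f = f} i (allFin n) (inj₂ (Any.map (λ { refl → ≤-refl }) (∈-allFin j)))

record PredBijection {B B′ : Set} (P : B → Set) (P′ : B′ → Set) : Set where
  field
    to      : B → B′
    from    : B′ → B
    to-P    : ∀ {x} → P x → P′ (to x)
    from-P  : ∀ {y} → P′ y → P (from y)
    from-to : ∀ {x} → P x → from (to x) ≡ x
    to-from : ∀ {y} → P′ y → to (from y) ≡ y

  inverse : PredBijection P′ P
  inverse = record { to = from ; from = to ; to-P = from-P ; from-P = to-P ; from-to = to-from ; to-from = from-to }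

module _ {B : Set} {P : B → Set} {R : B → B → Set} {φ : B → B} (φ-aut : IsAut P R φ) where

  aut-P : ∀ {x} → P x → P (φ x)
  aut-P = proj₁ φ-aut _

  aut-injective : ∀ {x y} → P x → P y → φ x ≡ φ y → x ≡ y
  aut-injective {x} {y} x∈ y∈ eq with proj₂ φ-aut
  ... | (ψ , _ , ψφ , _) , _ = trans (sym (ψφ x x∈)) (trans (cong ψ eq) (ψφ y y∈))

  aut-adj : ∀ {x y} → P x → P y → R x y → R (φ x) (φ y)
  aut-adj x∈ y∈ = proj₁ (proj₂ (proj₂ φ-aut) _ _ x∈ y∈)

  aut-adj⁻ : ∀ {x y} → P x → P y → R (φ x) (φ y) → R x y
  aut-adj⁻ x∈ y∈ = proj₂ (proj₂ (proj₂ φ-aut) _ _ x∈ y∈)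

  replace-relation : {R′ : B → B → Set} →
    (∀ x y → P x → P y → (R′ x y → R′ (φ x) (φ y)) × (R′ (φ x) (φ y) → R′ x y)) → IsAut P R′ φ
  replace-relation R′-preserved = proj₁ φ-aut , proj₁ (proj₂ φ-aut) , R′-preserved

  aut-resp : {R′ : B → B → Set} →
    (∀ x y → P x → P y → (R x y → R′ x y) × (R′ x y → R x y)) → IsAut P R′ φ
  aut-resp R⇔R′ = replace-relation λ x y x∈ y∈ →
    (λ r′ → proj₁ (R⇔R′ _ _ (aut-P x∈) (aut-P y∈)) (aut-adj x∈ y∈ (proj₂ (R⇔R′ x y x∈ y∈) r′))) ,
    (λ r′ → proj₁ (R⇔R′ x y x∈ y∈) (aut-adj⁻ x∈ y∈ (proj₂ (R⇔R′ _ _ (aut-P x∈) (aut-P y∈)) r′)))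

id-isRootedAut : ∀ {B : Set} (P : B → Set) (R : B → B → Set) r → IsRootedAut P R r id
id-isRootedAut P R r = ((λ _ x∈ → x∈) , (id , (λ _ x∈ → x∈) , (λ _ _ → refl) , (λ _ _ → refl)) , (λ _ _ _ _ → id , id)) , refl

module _ {B B′ : Set} {P : B → Set} {P′ : B′ → Set} (iso : PredBijection P P′) where
  open PredBijection iso

  conjugate-aut : ∀ {R : B → B → Set} {r φ} → P r → IsRootedAut P R r φ →
                  IsRootedAut P′ (λ a b → R (from a) (from b)) (to r) (to ∘ φ ∘ from)
  conjugate-aut {R} {r} {φ} r∈ ((φ-P , (ψ , ψ-P , ψφ , φψ) , φ-R) , φ-r) =
    ((λ y y∈ → to-P (φ-P _ (from-P y∈))) ,
     (to ∘ ψ ∘ from , (λ y y∈ → to-P (ψ-P _ (from-P y∈))) , inverse-law ψ φ ψ-P φ-P ψφ , inverse-law φ ψ φ-P ψ-P φψ) ,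
     relation) ,
    cong to (trans (cong φ (from-to r∈)) φ-r)
    where
    inverse-law : ∀ f g → (∀ x → P x → P (f x)) → (∀ x → P x → P (g x)) → (∀ x → P x → f (g x) ≡ x) →
                  ∀ y → P′ y → to (f (from (to (g (from y))))) ≡ y
    inverse-law f g f-P g-P fg y y∈ =
      trans (cong (to ∘ f) (from-to (g-P _ (from-P y∈)))) (trans (cong to (fg _ (from-P y∈))) (to-from y∈))
    relation : ∀ a b → P′ a → P′ b →
      (R (from a) (from b) → R (from (to (φ (from a)))) (from (to (φ (from b))))) ×
      (R (from (to (φ (from a)))) (from (to (φ (from b)))) → R (from a) (from b))
    relation a b a∈ b∈ =
      (λ r → subst₂ R (sym (from-to (φ-P _ (from-P a∈)))) (sym (from-to (φ-P _ (from-P b∈))))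
               (proj₁ (φ-R _ _ (from-P a∈) (from-P b∈)) r)) ,
      (λ r → proj₂ (φ-R _ _ (from-P a∈) (from-P b∈))
               (subst₂ R (from-to (φ-P _ (from-P a∈))) (from-to (φ-P _ (from-P b∈))) r))

module Transport {B B′ : Set} {P : B → Set} {P′ : B′ → Set} (iso : PredBijection P P′)
  {R : B → B → Set} {R′ : B′ → B′ → Set} {r : B} {r′ : B′} (k : ℕ)
  (conj-to : ∀ {φ} → IsRootedAut P R r φ → IsRootedAut P′ R′ r′ (PredBijection.to iso ∘ φ ∘ PredBijection.from iso))
  (conj-from : ∀ {Ψ} → IsRootedAut P′ R′ r′ Ψ → IsRootedAut P R r (PredBijection.from iso ∘ Ψ ∘ PredBijection.to iso))
  where
  open PredBijection iso

  pullback : DistColoring P R r k → DistColoring P′ R′ r′ k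
  pullback (f , f-dist) = f ∘ from , dist
    where
    dist : Distinguishes P′ R′ r′ k (f ∘ from)
    dist Ψ Ψ-aut Ψ-pres y y∈ = begin
      Ψ y                      ≡⟨ cong Ψ (sym (to-from y∈)) ⟩
      Ψ (to (from y))          ≡⟨ sym (to-from (aut-P (proj₁ Ψ-aut) (to-P (from-P y∈)))) ⟩
      to (from (Ψ (to (from y)))) ≡⟨ cong to (f-dist _ (conj-from Ψ-aut) f-pres (from y) (from-P y∈)) ⟩
      to (from y)              ≡⟨ to-from y∈ ⟩
      y                        ∎
      where
      open ≡-Reasoning
      f-pres : ∀ x → P x → f x ≡ f (from (Ψ (to x)))
      f-pres x x∈ = trans (cong f (sym (from-to x∈))) (Ψ-pres (to x) (to-P x∈))

  pullback-respects : ∀ a b → EquivCol P R r k a b → EquivCol P′ R′ r′ k (pullback a) (pullback b)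
  pullback-respects (f₁ , _) (f₂ , _) (φ , φ-aut , f₁≡f₂∘φ) =
    to ∘ φ ∘ from , conj-to φ-aut ,
    λ y y∈ → trans (f₁≡f₂∘φ _ (from-P y∈)) (cong f₂ (sym (from-to (aut-P (proj₁ φ-aut) (from-P y∈)))))

transport-classes : ∀ {B B′ : Set} {P : B → Set} {P′ : B′ → Set} (iso : PredBijection P P′)
  {R : B → B → Set} {R′ : B′ → B′ → Set} {r : B} {r′ : B′} (k : ℕ) →
  (∀ {φ} → IsRootedAut P R r φ → IsRootedAut P′ R′ r′ (PredBijection.to iso ∘ φ ∘ PredBijection.from iso)) →
  (∀ {Ψ} → IsRootedAut P′ R′ r′ Ψ → IsRootedAut P R r (PredBijection.from iso ∘ Ψ ∘ PredBijection.to iso)) →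
  SameNumberOfClasses (DistColoring P R r k) (EquivCol P R r k) (DistColoring P′ R′ r′ k) (EquivCol P′ R′ r′ k)
transport-classes {P = P} {P′} iso {R} {R′} {r} {r′} k conj-to conj-from =
  forward.pullback , backward.pullback , forward.pullback-respects , backward.pullback-respects ,
  (λ (f , _) → id , id-isRootedAut P R r , λ x x∈ → cong f (from-to x∈)) ,
  (λ (f , _) → id , id-isRootedAut P′ R′ r′ , λ y y∈ → cong f (to-from y∈))
  where
  open PredBijection iso
  module forward = Transport iso k conj-to conj-from
  module backward = Transport (inverse) k conj-from conj-to

module Walks {n : ℕ} (adj : Fin n → Fin n → Bool) where
  open Graph adj
  open import Data.List.Membership.DecPropositional (_≟ᶠ_ {n}) using (_∈?_) public

  verts-source : ∀ {a b} (p : Walk a b) → ∃ λ t → verts p ≡ a ∷ t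
  verts-source (nil v) = [] , refl
  verts-source (cons _ _ p) = verts p , refl

  source∈verts : ∀ {a b} (p : Walk a b) → a ∈ verts p
  source∈verts (nil v) = here refl
  source∈verts (cons _ _ p) = here refl

  target∈verts : ∀ {a b} (p : Walk a b) → b ∈ verts p
  target∈verts (nil v) = here refl
  target∈verts (cons _ _ p) = there (target∈verts p)

  length-verts : ∀ {a b} (p : Walk a b) → length (verts p) ≡ suc (len p)
  length-verts (nil v) = refl
  length-verts (cons _ _ p) = cong suc (length-verts p)

  verts⇒len : ∀ {a b c d} (p : Walk a b) (q : Walk c d) → verts p ≡ verts q → len p ≡ len q
  verts⇒len p q eq = suc-injective (trans (sym (length-verts p)) (trans (cong length eq) (length-verts q)))

  record Split {a b} (p : Walk a b) (x : Fin n) : Set where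
    field
      front         : Walk a x
      back          : Walk x b
      prefix        : List (Fin n)
      verts≡        : verts p ≡ prefix ++ verts back
      length-prefix : length prefix ≡ len front
      len≡          : len p ≡ len front + len back
      front⊆        : verts front ⊆ verts p

  splitAt : ∀ {a b x} (p : Walk a b) → x ∈ verts p → Split p x
  splitAt (nil v) (here refl) = record
    { front = nil v ; back = nil v ; prefix = [] ; verts≡ = refl
    ; length-prefix = refl ; len≡ = refl ; front⊆ = id }
  splitAt (cons a a~w p) (here refl) = record
    { front = nil a ; back = cons a a~w p ; prefix = [] ; verts≡ = refl
    ; length-prefix = refl ; len≡ = refl ; front⊆ = λ { (here eq) → here eq } }
  splitAt (cons a a~w p) (there x∈p) = record
    { front = cons a a~w front ; back = back ; prefix = a ∷ prefix
    ; verts≡ = cong (a ∷_) verts≡ ; length-prefix = cong suc length-prefix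
    ; len≡ = cong suc len≡
    ; front⊆ = λ { (here eq) → here eq ; (there y∈) → there (front⊆ y∈) } }
    where open Split (splitAt p x∈p)

  record Shortcut {a b} (p : Walk a b) : Set where
    field
      short        : Walk a b
      short-isPath : IsPath short
      short-len≤   : len short ≤ len p
      short⊆       : verts short ⊆ verts p

  shortcut : ∀ {a b} (p : Walk a b) → Shortcut p
  shortcut (nil v) = record { short = nil v ; short-isPath = [] ∷ [] ; short-len≤ = z≤n ; short⊆ = id }
  shortcut (cons a a~w p) with shortcut p
  ... | record { short = q ; short-isPath = uq ; short-len≤ = lq ; short⊆ = sq } with a ∈? verts q
  ...   | yes a∈q = record
    { short = back
    ; short-isPath = Unique-++⁻ʳ prefix (subst Unique verts≡ uq)
    ; short-len≤ = ≤-trans (≤-trans (m≤n+m (len back) (len front)) (≤-reflexive (sym len≡))) (m≤n⇒m≤1+n lq)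
    ; short⊆ = λ x∈ → there (sq (subst (_ ∈_) (sym verts≡) (∈-++⁺ʳ prefix x∈))) }
    where open Split (splitAt q a∈q)
  ...   | no a∉q = record
    { short = cons a a~w q
    ; short-isPath = ¬Any⇒All¬ _ a∉q ∷ uq
    ; short-len≤ = s≤s lq
    ; short⊆ = λ { (here eq) → here eq ; (there x∈) → there (sq x∈) } }

  snocʷ : ∀ {a b c} → Walk a b → Adj b c → Walk a c
  snocʷ (nil v) b~c = cons v b~c (nil _)
  snocʷ (cons x x~y p) b~c = cons x x~y (snocʷ p b~c)

  verts-snocʷ : ∀ {a b c} (p : Walk a b) (b~c : Adj b c) → verts (snocʷ p b~c) ≡ verts p ∷ʳ c
  verts-snocʷ (nil v) b~c = refl
  verts-snocʷ (cons x _ p) b~c = cong (x ∷_) (verts-snocʷ p b~c)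

  len-snocʷ : ∀ {a b c} (p : Walk a b) (b~c : Adj b c) → len (snocʷ p b~c) ≡ suc (len p)
  len-snocʷ (nil v) b~c = refl
  len-snocʷ (cons x _ p) b~c = cong suc (len-snocʷ p b~c)

  _++ʷ_ : ∀ {a b c} → Walk a b → Walk b c → Walk a c
  nil v ++ʷ q = q
  cons x x~y p ++ʷ q = cons x x~y (p ++ʷ q)

  ∈-++ʷ⁻ : ∀ {a b c} (p : Walk a b) (q : Walk b c) {x} → x ∈ verts (p ++ʷ q) → x ∈ verts p ⊎ x ∈ verts q
  ∈-++ʷ⁻ (nil v) q x∈ = inj₂ x∈
  ∈-++ʷ⁻ (cons y _ p) q (here eq) = inj₁ (here eq)
  ∈-++ʷ⁻ (cons y _ p) q (there x∈) = ⊎-map₁ there (∈-++ʷ⁻ p q x∈)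

  lastStep-cons : ∀ {a w b} (a~w : Adj a w) (p : Walk w b) →
                  Σ (Fin n) λ x → Adj x b × x ∈ verts (cons a a~w p)
  lastStep-cons {a} a~w (nil _) = a , a~w , here refl
  lastStep-cons _ (cons _ w~x p) with lastStep-cons w~x p
  ... | x , x~b , x∈p = x , x~b , there x∈p

  lastStep : ∀ {a b} (p : Walk a b) → ¬ a ≡ b → Σ (Fin n) λ x → Adj x b × x ∈ verts p
  lastStep (nil _) a≢b = ⊥-elim (a≢b refl)
  lastStep (cons _ a~w p) _ = lastStep-cons a~w p

  module Reverse (sym-adj : ∀ x y → Adj x y → Adj y x) where

    reverseʷ : ∀ {a b} → Walk a b → Walk b a
    reverseʷ (nil v) = nil v
    reverseʷ (cons x x~y p) = snocʷ (reverseʷ p) (sym-adj _ _ x~y)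

    len-reverseʷ : ∀ {a b} (p : Walk a b) → len (reverseʷ p) ≡ len p
    len-reverseʷ (nil v) = refl
    len-reverseʷ (cons x _ p) = trans (len-snocʷ (reverseʷ p) _) (cong suc (len-reverseʷ p))

    ∈-reverseʷ⁻ : ∀ {a b} (p : Walk a b) → verts (reverseʷ p) ⊆ verts p
    ∈-reverseʷ⁻ (nil v) x∈ = x∈
    ∈-reverseʷ⁻ (cons x _ p) x∈ with ∈-++⁻ (verts (reverseʷ p)) (subst (_ ∈_) (verts-snocʷ (reverseʷ p) _) x∈)
    ... | inj₁ x∈p = there (∈-reverseʷ⁻ p x∈p)
    ... | inj₂ (here eq) = here eq

    reverseʷ-isPath : ∀ {a b} (p : Walk a b) → IsPath p → IsPath (reverseʷ p)
    reverseʷ-isPath (nil v) u = u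
    reverseʷ-isPath (cons x _ p) (x∉ ∷ u) =
      subst Unique (sym (verts-snocʷ (reverseʷ p) _))
        (Unique-∷ʳ (reverseʷ-isPath p u) (All¬⇒¬Any x∉ ∘ ∈-reverseʷ⁻ p))

module Rooted {n : ℕ} (adj : Fin n → Fin n → Bool) (T : Graph.IsTree adj) (u : Fin n) where
  open Graph adj
  open Walks adj

  sym-adj : ∀ x y → Adj x y → Adj y x
  sym-adj = proj₁ (proj₂ T)

  irrefl-adj : ∀ x → ¬ Adj x x
  irrefl-adj = proj₁ (proj₂ (proj₂ T))

  path : ∀ a b → Σ (Walk a b) IsPath
  path = proj₁ (proj₂ (proj₂ (proj₂ T)))

  path-unique : ∀ a b (p q : Walk a b) → IsPath p → IsPath q → verts p ≡ verts q
  path-unique = proj₂ (proj₂ (proj₂ (proj₂ T)))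

  open Reverse sym-adj public

  toRoot : Fin n → List (Fin n)
  toRoot x = verts (proj₁ (path x u))

  -- the root has depth 1, not 0
  depth : Fin n → ℕ
  depth x = length (toRoot x)

  path⇒toRoot : ∀ {x} (p : Walk x u) → IsPath p → verts p ≡ toRoot x
  path⇒toRoot {x} p p-path = path-unique x u p _ p-path (proj₂ (path x u))

  toRoot-Unique : ∀ x → Unique (toRoot x)
  toRoot-Unique x = proj₂ (path x u)

  toRoot-root : toRoot u ≡ [ u ]
  toRoot-root = sym (path⇒toRoot (nil u) ([] ∷ []))

  depth-root : depth u ≡ 1
  depth-root = cong length toRoot-root

  ∈-toRoot : ∀ x → x ∈ toRoot x
  ∈-toRoot x = source∈verts (proj₁ (path x u))

  toRoot-∷⇒≡ : ∀ {x y ys} → toRoot x ≡ y ∷ ys → x ≡ y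
  toRoot-∷⇒≡ {x} eq with verts-source (proj₁ (path x u))
  ... | _ , eq′ = ∷-injectiveˡ (trans (sym eq′) eq)

  toRoot-injective : ∀ {x y} → toRoot x ≡ toRoot y → x ≡ y
  toRoot-injective {x} {y} eq with verts-source (proj₁ (path y u))
  ... | _ , eq′ = toRoot-∷⇒≡ (trans eq eq′)

  toRoot-cons : ∀ {a b} → Adj a b → a ∉ toRoot b → toRoot a ≡ a ∷ toRoot b
  toRoot-cons {a} {b} a~b a∉ =
    sym (path⇒toRoot (cons a a~b (proj₁ (path b u))) (¬Any⇒All¬ _ a∉ ∷ toRoot-Unique b))

  toRoot-suffix : ∀ {x y} → y ∈ toRoot x →
    Σ (List (Fin n)) λ pre → toRoot x ≡ pre ++ toRoot y × Σ (Walk x y) λ p → len p ≡ length pre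
  toRoot-suffix {x} y∈ = prefix , trans verts≡ (cong (prefix ++_) back≡) , front , sym length-prefix
    where
    open Split (splitAt (proj₁ (path x u)) y∈)
    back≡ : verts back ≡ toRoot _
    back≡ = path⇒toRoot back (Unique-++⁻ʳ prefix (subst Unique verts≡ (toRoot-Unique x)))

  toRoot-from : ∀ {z y} pre {ys} → toRoot z ≡ pre ++ y ∷ ys → toRoot y ≡ y ∷ ys
  toRoot-from {z} {y} pre eq with toRoot-suffix {z} {y} (subst (y ∈_) (sym eq) (∈-++⁺ʳ pre (here refl)))
  ... | pre′ , eq′ , _ with verts-source (proj₁ (path y u))
  ...   | _ , y-src =
    trans y-src (cong (y ∷_) (sym (Unique-suffix pre pre′ (subst Unique eq (toRoot-Unique z))
      (trans (sym eq) (trans eq′ (cong (pre′ ++_) y-src))))))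

  depth-suffix : ∀ {z x} pre → toRoot z ≡ pre ++ toRoot x → depth z ≡ length pre + depth x
  depth-suffix pre eq = trans (cong length eq) (length-++ pre)

  second : ∀ {a b} → Walk a b → Fin n
  second (nil v) = v
  second (cons _ {w} _ _) = w

  second-step : ∀ {a b} (p : Walk a b) → ¬ a ≡ b →
    Adj a (second p) × Σ (Walk (second p) b) λ q → verts p ≡ a ∷ verts q
  second-step (nil v) a≢b = ⊥-elim (a≢b refl)
  second-step (cons a a~w p) _ = a~w , p , refl

  parent : Fin n → Fin n
  parent x = second (proj₁ (path x u))

  parent-adj : ∀ x → ¬ x ≡ u → Adj x (parent x)
  parent-adj x x≢u = proj₁ (second-step (proj₁ (path x u)) x≢u)

  Child : Fin n → Fin n → Set
  Child c x = toRoot c ≡ c ∷ toRoot x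

  parent-child : ∀ x → ¬ x ≡ u → Child x (parent x)
  parent-child x x≢u with second-step (proj₁ (path x u)) x≢u
  ... | _ , q , eq = trans eq (cong (x ∷_) (path⇒toRoot q (Unique-++⁻ʳ [ x ] (subst Unique eq (toRoot-Unique x)))))

  depth-child : ∀ {c x} → Child c x → depth c ≡ suc (depth x)
  depth-child = cong length

  depth-parent : ∀ x → ¬ x ≡ u → depth x ≡ suc (depth (parent x))
  depth-parent x x≢u = depth-child (parent-child x x≢u)

  parent-≢ : ∀ x → ¬ x ≡ u → ¬ x ≡ parent x
  parent-≢ x x≢u eq = 1+n≢n (trans (sym (depth-parent x x≢u)) (cong depth eq))

  child≢root : ∀ {c x} → Child c x → ¬ c ≡ u
  child≢root {c} {x} c∷ refl with verts-source (proj₁ (path x u))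
  ... | _ , eq = 0≢1+n (suc-injective (trans (sym depth-root) (trans (depth-child c∷) (cong (suc ∘ length) eq))))

  child⇒parent : ∀ {c x} → Child c x → parent c ≡ x
  child⇒parent {c} c∷ = toRoot-injective (∷-injectiveʳ (trans (sym (parent-child c (child≢root c∷))) c∷))

  child⇒adj : ∀ {c x} → Child c x → Adj c x
  child⇒adj {c} c∷ = subst (Adj c) (child⇒parent c∷) (parent-adj c (child≢root c∷))

  adj⇒child⊎child : ∀ {v w} → Adj v w → Child v w ⊎ Child w v
  adj⇒child⊎child {v} {w} v~w with v ∈? toRoot w
  ... | no v∉ = inj₁ (toRoot-cons v~w v∉)
  ... | yes v∈ with toRoot-suffix {w} {v} v∈
  ...   | [] , eq , _ = ⊥-elim (irrefl-adj v (subst (Adj v) (toRoot-injective eq) v~w))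
  ...   | y ∷ pre , eq , _ = inj₂ (toRoot-cons (sym-adj v w v~w)
    (Unique-++⇒∉ (y ∷ pre) (subst Unique eq (toRoot-Unique w)) (here (toRoot-∷⇒≡ eq))))

  adj⇒parent : ∀ {x y} → Adj x y → parent x ≡ y ⊎ parent y ≡ x
  adj⇒parent x~y = ⊎-map child⇒parent child⇒parent (adj⇒child⊎child x~y)

  parent⇒adj : ∀ {x y} → ¬ x ≡ u → ¬ y ≡ u → parent x ≡ y ⊎ parent y ≡ x → Adj x y
  parent⇒adj {x} x≢u _ (inj₁ eq) = subst (Adj x) eq (parent-adj x x≢u)
  parent⇒adj {x} {y} _ y≢u (inj₂ eq) = sym-adj y x (subst (Adj y) eq (parent-adj y y≢u))

  parent-depth< : ∀ x → ¬ x ≡ u → depth (parent x) < depth x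
  parent-depth< x x≢u = ≤-reflexive (sym (depth-parent x x≢u))

  depth-gap : ∀ {z x} pre → toRoot z ≡ pre ++ toRoot x → depth z ∸ depth x ≡ length pre
  depth-gap {x = x} pre eq = trans (cong (_∸ depth x) (depth-suffix pre eq)) (m+n∸n≡m (length pre) (depth x))

  -- abstract, so that with-abstraction over goals mentioning height does not unfold it
  abstract
    -- how far z lies below x, and 0 when z is not a descendant of x
    below : Fin n → Fin n → ℕ
    below x z with x ∈? toRoot z
    ... | yes _ = depth z ∸ depth x
    ... | no _  = 0

    height : Fin n → ℕ
    height x = below x (argmaxFin (below x) x)

    below-suffix : ∀ {x z} pre → toRoot z ≡ pre ++ toRoot x → below x z ≡ length pre
    below-suffix {x} {z} pre eq with x ∈? toRoot z
    ... | yes _  = depth-gap pre eq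
    ... | no x∉ = ⊥-elim (x∉ (subst (x ∈_) (sym eq) (∈-++⁺ʳ pre (∈-toRoot x))))

    below-cases : ∀ x z → (Σ (List (Fin n)) λ pre → toRoot z ≡ pre ++ toRoot x × below x z ≡ length pre)
                          ⊎ below x z ≡ 0
    below-cases x z with x ∈? toRoot z
    ... | no _ = inj₂ refl
    ... | yes x∈ with toRoot-suffix x∈
    ...   | pre , eq , _ = inj₁ (pre , eq , depth-gap pre eq)

    suffix≤height : ∀ {x z} pre → toRoot z ≡ pre ++ toRoot x → length pre ≤ height x
    suffix≤height {x} {z} pre eq = subst (_≤ height x) (below-suffix pre eq) (≤-argmaxFin (below x) x z)

    height-attained : ∀ x →
      Σ (Fin n) λ z → Σ (List (Fin n)) λ pre → toRoot z ≡ pre ++ toRoot x × height x ≡ length pre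
    height-attained x with below-cases x (argmaxFin (below x) x)
    ... | inj₁ (pre , eq , h≡) = _ , pre , eq , h≡
    ... | inj₂ h≡ = x , [] , refl , h≡

  height-ancestor : ∀ {v y} pre → toRoot v ≡ pre ++ toRoot y → height v + length pre ≤ height y
  height-ancestor {v} {y} pre eq with height-attained v
  ... | z , pre₁ , eq₁ , h≡ = subst (_≤ height y) lengths (suffix≤height (pre₁ ++ pre) z≡)
    where
    z≡ : toRoot z ≡ (pre₁ ++ pre) ++ toRoot y
    z≡ = trans eq₁ (trans (cong (pre₁ ++_) eq) (sym (++-assoc pre₁ pre (toRoot y))))
    lengths : length (pre₁ ++ pre) ≡ height v + length pre
    lengths = trans (length-++ pre₁) (cong (_+ length pre) (sym h≡))

  height-child : ∀ {c x} → Child c x → suc (height c) ≤ height x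
  height-child {c} {x} c∷ = subst (_≤ height x) (+-comm (height c) 1) (height-ancestor [ c ] c∷)

  tallest-child : ∀ x → 1 ≤ height x → Σ (Fin n) λ c → Child c x × height x ≤ suc (height c)
  tallest-child x 1≤h with height-attained x
  ... | z , pre , eq , h≡ with initLast pre
  ...   | [] = ⊥-elim (1+n≰n (subst (1 ≤_) h≡ 1≤h))
  ...   | pre′ ∷ʳ′ c = c , c∷ , subst (_≤ suc (height c)) (sym h≡′) (s≤s (suffix≤height pre′ z≡′))
    where
    z≡ : toRoot z ≡ pre′ ++ c ∷ toRoot x
    z≡ = trans eq (++-assoc pre′ [ c ] (toRoot x))
    c∷ : Child c x
    c∷ = toRoot-from pre′ z≡
    z≡′ : toRoot z ≡ pre′ ++ toRoot c
    z≡′ = trans z≡ (cong (pre′ ++_) (sym c∷))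
    h≡′ : height x ≡ suc (length pre′)
    h≡′ = trans h≡ (trans (length-++ pre′) (+-comm (length pre′) 1))

  dist : Fin n → Fin n → ℕ
  dist a b = len (proj₁ (path a b))

  dist≤len : ∀ {a b} (p : Walk a b) → dist a b ≤ len p
  dist≤len {a} {b} p = subst (_≤ len p) (verts⇒len short _ short≡) short-len≤
    where
    open Shortcut (shortcut p)
    short≡ : verts short ≡ verts (proj₁ (path a b))
    short≡ = path-unique a b short _ short-isPath (proj₂ (path a b))

  isDist : ∀ a b → IsDist a b (dist a b)
  isDist a b = (proj₁ (path a b) , refl) , dist≤len

  ecc : Fin n → ℕ
  ecc x = dist x (argmaxFin (dist x) x)

  isEcc : ∀ x → IsEcc x (ecc x)
  isEcc x = (λ z d zd → ≤-trans (proj₂ zd (proj₁ (path x z))) (≤-argmaxFin (dist x) x z)) , (_ , isDist x _)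

  ecc≤ : ∀ {x m} → (∀ z → dist x z ≤ m) → ecc x ≤ m
  ecc≤ {x} bound = bound (argmaxFin (dist x) x)

  dist≤ecc : ∀ {x e} z → IsEcc x e → dist x z ≤ e
  dist≤ecc {x} z x-ecc = proj₁ x-ecc z (dist x z) (isDist x z)

  suc-dist-root : ∀ z → suc (dist u z) ≡ depth z
  suc-dist-root z = begin
    suc (dist u z)         ≡⟨ cong suc (sym (len-reverseʷ p)) ⟩
    suc (len (reverseʷ p)) ≡⟨ sym (length-verts (reverseʷ p)) ⟩
    length (verts (reverseʷ p)) ≡⟨ cong length (path⇒toRoot (reverseʷ p) (reverseʷ-isPath p (proj₂ (path u z)))) ⟩
    depth z                ∎
    where
    open ≡-Reasoning
    p : Walk u z
    p = proj₁ (path u z)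

  module _ {c : Fin n} (c∷ : Child c u) where

    ecc-root>height : ∀ {e} → IsEcc u e → suc (height c) ≤ e
    ecc-root>height {e} u-ecc with height-attained c
    ... | z , pre , eq , h≡ = subst (_≤ e) dist≡ (dist≤ecc z u-ecc)
      where
      open ≡-Reasoning
      dist≡ : dist u z ≡ suc (height c)
      dist≡ = suc-injective (begin
        suc (dist u z)       ≡⟨ suc-dist-root z ⟩
        depth z              ≡⟨ depth-suffix pre eq ⟩
        length pre + depth c ≡⟨ cong₂ _+_ (sym h≡) (trans (depth-child c∷) (cong suc depth-root)) ⟩
        height c + 2         ≡⟨ +-comm (height c) 2 ⟩
        suc (suc (height c)) ∎)

    walk≤height : 1 ≤ height c → (∀ w → Adj u w → ¬ w ≡ c → suc (suc (height w)) ≤ height c) →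
                  ∀ z → Σ (Walk c z) λ p → len p ≤ height c
    walk≤height 1≤h low z with c ∈? toRoot z
    ... | yes c∈ with toRoot-suffix c∈
    ...   | pre , eq , p , p≡ = reverseʷ p , subst (_≤ height c) (sym (trans (len-reverseʷ p) p≡)) (suffix≤height pre eq)
    walk≤height 1≤h low z | no c∉ with z ≟ᶠ u
    ... | yes refl = cons c (child⇒adj c∷) (nil u) , 1≤h
    ... | no z≢u with lastStep (proj₁ (path z u)) z≢u
    ...   | w , w~u , w∈ with toRoot-suffix w∈
    ...     | pre , eq , p , p≡ =
      cons c (child⇒adj c∷) (cons u (sym-adj w u w~u) (reverseʷ p)) ,
      ≤-trans (s≤s (s≤s p≤)) (low w (sym-adj w u w~u) w≢c)
      where
      p≤ : len (reverseʷ p) ≤ height w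
      p≤ = subst (_≤ height w) (sym (trans (len-reverseʷ p) p≡)) (suffix≤height pre eq)
      w≢c : ¬ w ≡ c
      w≢c refl = c∉ w∈

  -- If every other branch at u were two levels shorter than the branch at c, then c would have
  -- smaller eccentricity than u.
  rival-branch : InCenter u → ∀ {c} → Child c u → 1 ≤ height c →
                 Σ (Fin n) λ w → Adj u w × ¬ w ≡ c × height c ≤ suc (height w)
  rival-branch (e , u-ecc , u-min) {c} c∷ 1≤h
    with any? (λ w → (adj u w ≟ᵇ true) ×-dec (¬? (w ≟ᶠ c) ×-dec (height c ≤? suc (height w))))
  ... | yes found = found
  ... | no none = ⊥-elim (1+n≰n (≤-trans (ecc-root>height c∷ u-ecc) (≤-trans (u-min c (ecc c) (isEcc c)) ecc-c≤)))
    where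
    low : ∀ w → Adj u w → ¬ w ≡ c → suc (suc (height w)) ≤ height c
    low w u~w w≢c = ≰⇒> λ le → none (w , u~w , w≢c , le)
    ecc-c≤ : ecc c ≤ height c
    ecc-c≤ = ecc≤ λ z → let (p , p≤) = walk≤height c∷ 1≤h low z in ≤-trans (dist≤len p) p≤

  child-depth< : ∀ {c x} → Child c x → depth x < depth c
  child-depth< c∷ = ≤-reflexive (sym (depth-child c∷))

  parent≢child : ∀ {c x} → Child c x → ¬ x ≡ u → ¬ parent x ≡ c
  parent≢child {x = x} c∷ x≢u eq =
    <-asym (parent-depth< x x≢u) (subst (depth x <_) (cong depth (sym eq)) (child-depth< c∷))

  parent²≢ : ∀ {x} → ¬ x ≡ u → ¬ parent x ≡ u → ¬ parent (parent x) ≡ x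
  parent²≢ {x} x≢u p≢u eq =
    <-irrefl (cong depth eq) (<-trans (parent-depth< (parent x) p≢u) (parent-depth< x x≢u))

  parent³≢ : ∀ {x} → ¬ x ≡ u → ¬ parent x ≡ u → ¬ parent (parent x) ≡ u → ¬ parent (parent (parent x)) ≡ x
  parent³≢ {x} x≢u p≢u pp≢u eq = <-irrefl (cong depth eq)
    (<-trans (parent-depth< (parent (parent x)) pp≢u) (<-trans (parent-depth< (parent x) p≢u) (parent-depth< x x≢u)))

  two-neighbours⇒¬leaf : ∀ {j x a b} → Adj x a → Adj x b → ¬ a ≡ b → InT j a → InT j b → ¬ IsLeafOf j x
  two-neighbours⇒¬leaf x~a x~b a≢b a∈ b∈ (_ , _ , _ , _ , unique) = a≢b (trans (unique _ x~a a∈) (sym (unique _ x~b b∈)))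

  InT-antitone : ∀ {k m x} → k ≤ m → InT m x → InT k x
  InT-antitone {k} {zero} z≤n _ = tt
  InT-antitone {k} {suc m} k≤ x∈ with k ≟ suc m
  ... | yes refl = x∈
  ... | no k≢ = InT-antitone (≤-pred (≤∧≢⇒< k≤ k≢)) (proj₁ x∈)

  leaf-level-unique : ∀ {j j′ x} → IsLeafOf j x → IsLeafOf j′ x → j ≡ j′
  leaf-level-unique {j} {j′} l l′ with <-cmp j j′
  ... | tri< j<j′ _ _ = ⊥-elim (proj₂ (InT-antitone j<j′ (proj₁ l′)) l)
  ... | tri≈ _ j≡j′ _ = j≡j′
  ... | tri> _ _ j′<j = ⊥-elim (proj₂ (InT-antitone j′<j (proj₁ l)) l′)

  InT⇔height≥ : ℕ → Set
  InT⇔height≥ j = ∀ x → (InT j x → j ≤ height x) × (j ≤ height x → InT j x)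

  height-leaf : ∀ {j} → InT⇔height≥ j → ∀ x → ¬ x ≡ u → height x ≡ j → IsLeafOf j x
  height-leaf {j} layer x x≢u h≡ =
    proj₂ (layer x) (≤-reflexive (sym h≡)) ,
    parent x , parent-adj x x≢u ,
    proj₂ (layer (parent x)) (subst (_≤ height (parent x)) h≡ (<⇒≤ (height-child (parent-child x x≢u)))) ,
    λ w x~w w∈ → [ (λ x∷ → sym (child⇒parent x∷))
                 , (λ w∷ → ⊥-elim (<⇒≱ (subst (height w <_) h≡ (height-child w∷)) (proj₁ (layer w) w∈))) ]′
                 (adj⇒child⊎child x~w)

  module Stripping (J : ℕ) (J≤root : J ≤ height u)
    (two-branches : ∀ j → j < J → Σ (Fin n) λ a → Σ (Fin n) λ b →
                      Adj u a × Adj u b × ¬ a ≡ b × j ≤ height a × j ≤ height b) where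

    layer-step : ∀ j → j < J → InT⇔height≥ j → InT⇔height≥ (suc j)
    layer-step j j<J layer x with x ≟ᶠ u
    ... | yes refl = (λ _ → ≤-trans j<J J≤root) , λ j<h → proj₂ (layer u) (<⇒≤ j<h) , root-inner
      where
      root-inner : ¬ IsLeafOf j u
      root-inner with two-branches j j<J
      ... | a , b , u~a , u~b , a≢b , j≤a , j≤b =
        two-neighbours⇒¬leaf u~a u~b a≢b (proj₂ (layer a) j≤a) (proj₂ (layer b) j≤b)
    ... | no x≢u = into , onto
      where
      into : InT (suc j) x → j < height x
      into (x∈ , not-leaf) with j ≟ height x
      ... | yes j≡ = ⊥-elim (not-leaf (height-leaf layer x x≢u (sym j≡)))
      ... | no j≢ = ≤∧≢⇒< (proj₁ (layer x) x∈) j≢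
      onto : j < height x → InT (suc j) x
      onto j<h with tallest-child x (≤-trans (s≤s z≤n) j<h)
      ... | c , c∷ , h≤ =
        proj₂ (layer x) (<⇒≤ j<h) ,
        two-neighbours⇒¬leaf (parent-adj x x≢u) (sym-adj c x (child⇒adj c∷)) (parent≢child c∷ x≢u)
          (proj₂ (layer (parent x)) (<⇒≤ (<-trans j<h (height-child (parent-child x x≢u)))))
          (proj₂ (layer c) (≤-pred (≤-trans j<h h≤)))

    layers : ∀ j → j ≤ J → InT⇔height≥ j
    layers zero _ x = (λ _ → z≤n) , λ _ → tt
    layers (suc j) j<J = layer-step j j<J (layers j (<⇒≤ j<J))

module Edges {n : ℕ} (adj : Fin n → Fin n → Bool) where
  open Graph adj

  sortPair : Fin n → Fin n → Edge
  sortPair a b with toℕ a <? toℕ b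
  ... | yes _ = a , b
  ... | no _  = b , a

  sortPair-isPair : ∀ {a b} → ¬ a ≡ b → IsPair a b (sortPair a b)
  sortPair-isPair {a} {b} a≢b with toℕ a <? toℕ b
  ... | yes a<b = a<b , inj₁ (refl , refl)
  ... | no a≮b = ≤∧≢⇒< (≮⇒≥ a≮b) (λ eq → a≢b (sym (toℕ-injective eq))) , inj₂ (refl , refl)

  isPair⇒sortPair : ∀ {a b e} → IsPair a b e → e ≡ sortPair a b
  isPair⇒sortPair {a} {b} (a<b , inj₁ (refl , refl)) with toℕ a <? toℕ b
  ... | yes _ = refl
  ... | no a≮b = ⊥-elim (a≮b a<b)
  isPair⇒sortPair {a} {b} (b<a , inj₂ (refl , refl)) with toℕ a <? toℕ b
  ... | yes a<b = ⊥-elim (<-asym a<b b<a)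
  ... | no _ = refl

  _∈ᴱ_ : Fin n → Edge → Set
  z ∈ᴱ (x , y) = z ≡ x ⊎ z ≡ y

  ∈ᴱ-sortPair⁻ : ∀ {a b z} → z ∈ᴱ sortPair a b → z ≡ a ⊎ z ≡ b
  ∈ᴱ-sortPair⁻ {a} {b} z∈ with toℕ a <? toℕ b
  ... | yes _ = z∈
  ... | no _  = ⊎-swap z∈

  ∈ᴱ-sortPair⁺ : ∀ a b {z} → z ≡ a ⊎ z ≡ b → z ∈ᴱ sortPair a b
  ∈ᴱ-sortPair⁺ a b z∈ with toℕ a <? toℕ b
  ... | yes _ = z∈
  ... | no _  = ⊎-swap z∈

  Meet : Edge → Edge → Set
  Meet e₁ e₂ = Σ (Fin n) λ z → z ∈ᴱ e₁ × z ∈ᴱ e₂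

  lineAdj⇒meet : ∀ {e₁ e₂} → LAdj e₁ e₂ → ¬ e₁ ≡ e₂ × Meet e₁ e₂
  lineAdj⇒meet {x , y} (e₁≢e₂ , inj₁ eq) = e₁≢e₂ , x , inj₁ refl , inj₁ eq
  lineAdj⇒meet {x , y} (e₁≢e₂ , inj₂ (inj₁ eq)) = e₁≢e₂ , x , inj₁ refl , inj₂ eq
  lineAdj⇒meet {x , y} (e₁≢e₂ , inj₂ (inj₂ (inj₁ eq))) = e₁≢e₂ , y , inj₂ refl , inj₁ eq
  lineAdj⇒meet {x , y} (e₁≢e₂ , inj₂ (inj₂ (inj₂ eq))) = e₁≢e₂ , y , inj₂ refl , inj₂ eq

  meet⇒lineAdj : ∀ {e₁ e₂} → ¬ e₁ ≡ e₂ → Meet e₁ e₂ → LAdj e₁ e₂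
  meet⇒lineAdj e₁≢e₂ (_ , inj₁ refl , inj₁ refl) = e₁≢e₂ , inj₁ refl
  meet⇒lineAdj e₁≢e₂ (_ , inj₁ refl , inj₂ refl) = e₁≢e₂ , inj₂ (inj₁ refl)
  meet⇒lineAdj e₁≢e₂ (_ , inj₂ refl , inj₁ refl) = e₁≢e₂ , inj₂ (inj₂ (inj₁ refl))
  meet⇒lineAdj e₁≢e₂ (_ , inj₂ refl , inj₂ refl) = e₁≢e₂ , inj₂ (inj₂ (inj₂ refl))

module Branch {n : ℕ} (adj : Fin n → Fin n → Bool) (T : Graph.IsTree adj)
  (s vᵢ u : Fin n) (vᵢ∈S : Graph.InComp adj s vᵢ) (u-center : Graph.InCenter adj u)
  (vᵢ~u : Graph.Adj adj vᵢ u) where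
  open Graph adj
  open Walks adj
  open Rooted adj T u
  open Edges adj

  S : Fin n → Set
  S = InComp s

  S⁺ : Fin n → Set
  S⁺ x = x ≡ u ⊎ S x

  AvoidsCenter : ∀ {a b} → Walk a b → Set
  AvoidsCenter p = ∀ {x} → x ∈ verts p → ¬ InCenter x

  S-walk : ∀ {v y} → S v → (q : Walk v y) → AvoidsCenter q → S y
  S-walk (p , p-avoids) q q-avoids =
    p ++ʷ q , All.tabulate λ x∈ → [ All.lookup p-avoids , q-avoids ]′ (∈-++ʷ⁻ p q x∈)

  S⇒≢root : ∀ {v} → S v → ¬ v ≡ u
  S⇒≢root (p , p-avoids) refl = All.lookup p-avoids (target∈verts p) u-center

  toRoot-via-vᵢ : ∀ {v} → S v → Σ (Walk v vᵢ) λ q → AvoidsCenter q × toRoot v ≡ verts q ∷ʳ u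
  toRoot-via-vᵢ (p , p-avoids) = short , q-avoids , sym (trans (sym (verts-snocʷ short vᵢ~u)) (path⇒toRoot _ isPath))
    where
    open Shortcut (shortcut (reverseʷ p ++ʷ proj₁ vᵢ∈S))
    q-avoids : AvoidsCenter short
    q-avoids x∈ = [ All.lookup p-avoids ∘ ∈-reverseʷ⁻ p , All.lookup (proj₂ vᵢ∈S) ]′
                    (∈-++ʷ⁻ (reverseʷ p) _ (short⊆ x∈))
    isPath : IsPath (snocʷ short vᵢ~u)
    isPath = subst Unique (sym (verts-snocʷ short vᵢ~u)) (Unique-∷ʳ short-isPath λ u∈ → q-avoids u∈ u-center)

  ancestor-S⁺ : ∀ {v y} → S v → y ∈ toRoot v → S⁺ y
  ancestor-S⁺ {v} {y} v∈S y∈ with toRoot-via-vᵢ v∈S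
  ... | q , q-avoids , eq with ∈-++⁻ (verts q) (subst (y ∈_) eq y∈)
  ...   | inj₂ (here refl) = inj₁ refl
  ...   | inj₁ y∈q = inj₂ (S-walk v∈S front (q-avoids ∘ front⊆))
    where open Split (splitAt q y∈q)

  parent-S⁺ : ∀ {v} → S v → S⁺ (parent v)
  parent-S⁺ {v} v∈S = ancestor-S⁺ v∈S (subst (parent v ∈_) (sym (parent-child v (S⇒≢root v∈S))) (there (∈-toRoot _)))

  parent≡root⇒vᵢ : ∀ {v} → S v → parent v ≡ u → v ≡ vᵢ
  parent≡root⇒vᵢ {v} v∈S p≡u with toRoot-via-vᵢ v∈S
  ... | q , _ , eq = vᵢ∈[v] (subst (vᵢ ∈_) (∷ʳ-injectiveˡ (verts q) [ v ] (trans (sym eq) toRoot≡)) (target∈verts q))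
    where
    toRoot≡ : toRoot v ≡ [ v ] ∷ʳ u
    toRoot≡ = trans (parent-child v (S⇒≢root v∈S)) (cong (v ∷_) (trans (cong toRoot p≡u) toRoot-root))
    vᵢ∈[v] : vᵢ ∈ [ v ] → v ≡ vᵢ
    vᵢ∈[v] (here eq) = sym eq

  vᵢ-child : Child vᵢ u
  vᵢ-child = toRoot-cons vᵢ~u λ vᵢ∈ → S⇒≢root vᵢ∈S (vᵢ∈[u] (subst (vᵢ ∈_) toRoot-root vᵢ∈))
    where vᵢ∈[u] : vᵢ ∈ [ u ] → vᵢ ≡ u
          vᵢ∈[u] (here eq) = eq

  parent-vᵢ : parent vᵢ ≡ u
  parent-vᵢ = child⇒parent vᵢ-child

  height≤vᵢ : ∀ {v} → S v → height v ≤ height vᵢ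
  height≤vᵢ {v} v∈S with toRoot-via-vᵢ v∈S
  ... | q , _ , eq with toRoot-suffix (subst (vᵢ ∈_) (sym eq) (∈-++⁺ˡ (target∈verts q)))
  ...   | pre , eq′ , _ = ≤-trans (m≤m+n (height v) (length pre)) (height-ancestor pre eq′)

  two-branches : ∀ j → j < height vᵢ → Σ (Fin n) λ a → Σ (Fin n) λ b →
                   Adj u a × Adj u b × ¬ a ≡ b × j ≤ height a × j ≤ height b
  two-branches j j<h with rival-branch u-center vᵢ-child (≤-trans (s≤s z≤n) j<h)
  ... | w , u~w , w≢vᵢ , h≤ =
    vᵢ , w , sym-adj vᵢ u vᵢ~u , u~w , (λ eq → w≢vᵢ (sym eq)) , <⇒≤ j<h , ≤-pred (≤-trans j<h h≤)

  open Stripping (height vᵢ) (<⇒≤ (height-child vᵢ-child)) two-branches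

  leaf-at-height : ∀ {v} → S v → IsLeafOf (height v) v
  leaf-at-height {v} v∈S = height-leaf (layers (height v) (height≤vᵢ v∈S)) v (S⇒≢root v∈S) refl

  -- abstract for the same reason as height: unfolding these stalls the conjugation lemmas below
  abstract
    upEdge : Fin n → Edge
    upEdge v = sortPair v (parent v)

    deeperEnd : Edge → Fin n
    deeperEnd (x , y) with depth x <? depth y
    ... | yes _ = y
    ... | no _  = x

    upEdge-isEv : ∀ {v} → S v → IsEv v (upEdge v)
    upEdge-isEv {v} v∈S =
      height v , leaf , parent v , parent-adj v (S⇒≢root v∈S) , proj₁ (proj₂ (proj₂ (proj₂ leaf))) ,
      sortPair-isPair (parent-≢ v (S⇒≢root v∈S))
      where
      leaf : IsLeafOf (height v) v
      leaf = leaf-at-height v∈S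

    isEv⇒upEdge : ∀ {v e} → S v → IsEv v e → e ≡ upEdge v
    isEv⇒upEdge {v} v∈S (j , leaf , w , v~w , w∈T , pair) =
      trans (isPair⇒sortPair pair) (cong (sortPair v) w≡)
      where
      leaf′ : IsLeafOf (height v) v
      leaf′ = leaf-at-height v∈S
      w≡ : w ≡ parent v
      w≡ = proj₂ (proj₂ (proj₂ (proj₂ leaf′))) w v~w (subst (λ k → InT k w) (leaf-level-unique leaf leaf′) w∈T)

    deeperEnd-upEdge : ∀ {v} → ¬ v ≡ u → deeperEnd (upEdge v) ≡ v
    deeperEnd-upEdge {v} v≢u with toℕ v <? toℕ (parent v)
    ... | yes _ with depth v <? depth (parent v)
    ...   | yes v<p = ⊥-elim (<-asym v<p (parent-depth< v v≢u))
    ...   | no _    = refl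
    deeperEnd-upEdge {v} v≢u | no _ with depth (parent v) <? depth v
    ...   | yes _   = refl
    ...   | no p≮v = ⊥-elim (p≮v (parent-depth< v v≢u))

    ∈ᴱ-upEdge⁻ : ∀ {v z} → z ∈ᴱ upEdge v → z ≡ v ⊎ z ≡ parent v
    ∈ᴱ-upEdge⁻ = ∈ᴱ-sortPair⁻

    ∈ᴱ-upEdge⁺ : ∀ v {z} → z ≡ v ⊎ z ≡ parent v → z ∈ᴱ upEdge v
    ∈ᴱ-upEdge⁺ v = ∈ᴱ-sortPair⁺ v (parent v)

  S′ : Edge → Set
  S′ = InComp' s

  upEdge-S′ : ∀ {v} → S v → S′ (upEdge v)
  upEdge-S′ {v} v∈S = v , v∈S , upEdge-isEv v∈S

  upEdge-injective : ∀ {v w} → ¬ v ≡ u → ¬ w ≡ u → upEdge v ≡ upEdge w → v ≡ w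
  upEdge-injective v≢u w≢u eq =
    trans (sym (deeperEnd-upEdge v≢u)) (trans (cong deeperEnd eq) (deeperEnd-upEdge w≢u))

  S′⇒upEdge : ∀ {e} → S′ e → S (deeperEnd e) × upEdge (deeperEnd e) ≡ e
  S′⇒upEdge {e} (v , v∈S , e-isEv) = subst S (sym d≡) v∈S , trans (cong upEdge d≡) (sym e≡)
    where
    e≡ : e ≡ upEdge v
    e≡ = isEv⇒upEdge v∈S e-isEv
    d≡ : deeperEnd e ≡ v
    d≡ = trans (cong deeperEnd e≡) (deeperEnd-upEdge (S⇒≢root v∈S))

  AdjOrSiblings : Fin n → Fin n → Set
  AdjOrSiblings v w = ¬ v ≡ w × (parent v ≡ w ⊎ parent w ≡ v ⊎ parent v ≡ parent w)

  lineAdj⇒adjOrSiblings : ∀ {v w} → LAdj (upEdge v) (upEdge w) → AdjOrSiblings v w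
  lineAdj⇒adjOrSiblings {v} {w} ladj with lineAdj⇒meet ladj
  ... | e≢e , z , z∈v , z∈w = (e≢e ∘ cong upEdge) , ends (∈ᴱ-upEdge⁻ z∈v) (∈ᴱ-upEdge⁻ z∈w)
    where
    ends : ∀ {z} → z ≡ v ⊎ z ≡ parent v → z ≡ w ⊎ z ≡ parent w →
           parent v ≡ w ⊎ parent w ≡ v ⊎ parent v ≡ parent w
    ends (inj₁ refl) (inj₁ refl) = ⊥-elim (e≢e refl)
    ends (inj₁ refl) (inj₂ z≡) = inj₂ (inj₁ (sym z≡))
    ends (inj₂ z≡) (inj₁ refl) = inj₁ (sym z≡)
    ends (inj₂ z≡) (inj₂ z≡′) = inj₂ (inj₂ (trans (sym z≡) z≡′))

  adjOrSiblings⇒lineAdj : ∀ {v w} → ¬ v ≡ u → ¬ w ≡ u → AdjOrSiblings v w → LAdj (upEdge v) (upEdge w)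
  adjOrSiblings⇒lineAdj {v} {w} v≢u w≢u (v≢w , rel) =
    meet⇒lineAdj (v≢w ∘ upEdge-injective v≢u w≢u) (common rel)
    where
    common : parent v ≡ w ⊎ parent w ≡ v ⊎ parent v ≡ parent w → Meet (upEdge v) (upEdge w)
    common (inj₁ eq) = w , ∈ᴱ-upEdge⁺ v (inj₂ (sym eq)) , ∈ᴱ-upEdge⁺ w (inj₁ refl)
    common (inj₂ (inj₁ eq)) = v , ∈ᴱ-upEdge⁺ v (inj₁ refl) , ∈ᴱ-upEdge⁺ w (inj₂ (sym eq))
    common (inj₂ (inj₂ eq)) = parent v , ∈ᴱ-upEdge⁺ v (inj₂ refl) , ∈ᴱ-upEdge⁺ w (inj₂ eq)

  fixRoot : (Fin n → Fin n) → Fin n → Fin n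
  fixRoot φ x with x ≟ᶠ u
  ... | yes _ = u
  ... | no _  = φ x

  fixRoot-root : ∀ φ → fixRoot φ u ≡ u
  fixRoot-root φ with u ≟ᶠ u
  ... | yes _ = refl
  ... | no u≢u = ⊥-elim (u≢u refl)

  fixRoot-S : ∀ φ {x} → S x → fixRoot φ x ≡ φ x
  fixRoot-S φ {x} x∈S with x ≟ᶠ u
  ... | yes x≡u = ⊥-elim (S⇒≢root x∈S x≡u)
  ... | no _ = refl

  CommutesWithParent : (Fin n → Fin n) → Set
  CommutesWithParent φ = ∀ v → S v → parent (φ v) ≡ fixRoot φ (parent v)

  module _ {R : Fin n → Fin n → Set} {φ : Fin n → Fin n} (φ-aut : IsAut S R φ) where

    fixRoot-injective : ∀ {x y} → S⁺ x → S⁺ y → fixRoot φ x ≡ fixRoot φ y → x ≡ y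
    fixRoot-injective (inj₁ refl) (inj₁ refl) _ = refl
    fixRoot-injective (inj₁ refl) (inj₂ y∈S) eq =
      ⊥-elim (S⇒≢root (aut-P φ-aut y∈S) (trans (sym (fixRoot-S φ y∈S)) (trans (sym eq) (fixRoot-root φ))))
    fixRoot-injective (inj₂ x∈S) (inj₁ refl) eq =
      ⊥-elim (S⇒≢root (aut-P φ-aut x∈S) (trans (sym (fixRoot-S φ x∈S)) (trans eq (fixRoot-root φ))))
    fixRoot-injective (inj₂ x∈S) (inj₂ y∈S) eq =
      aut-injective φ-aut x∈S y∈S (trans (sym (fixRoot-S φ x∈S)) (trans eq (fixRoot-S φ y∈S)))

    parent-not-swapped : ∀ {v} → S v → S (parent v) →
      parent (φ (parent v)) ≡ fixRoot φ (parent (parent v)) → ¬ parent (φ (parent v)) ≡ φ v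
    parent-not-swapped {v} v∈S p∈S p-comm eq =
      parent²≢ (S⇒≢root v∈S) (S⇒≢root p∈S)
        (fixRoot-injective (parent-S⁺ p∈S) (inj₂ v∈S) (trans (sym p-comm) (trans eq (sym (fixRoot-S φ v∈S)))))

  commutes-by-descent : ∀ {φ} → φ vᵢ ≡ vᵢ →
    (∀ {v} → S v → S (parent v) → parent (φ (parent v)) ≡ fixRoot φ (parent (parent v)) → parent (φ v) ≡ φ (parent v)) →
    CommutesWithParent φ
  commutes-by-descent {φ} φvᵢ≡ step v v∈S = descend (depth v) v v∈S ≤-refl
    where
    descend : ∀ k v → S v → depth v ≤ k → parent (φ v) ≡ fixRoot φ (parent v)
    descend zero v v∈S d≤ = ⊥-elim (n≮0 (subst (_≤ 0) (depth-parent v (S⇒≢root v∈S)) d≤))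
    descend (suc k) v v∈S d≤ with parent-S⁺ v∈S
    ... | inj₁ p≡u = begin
      parent (φ v)  ≡⟨ cong (parent ∘ φ) (parent≡root⇒vᵢ v∈S p≡u) ⟩
      parent (φ vᵢ) ≡⟨ cong parent φvᵢ≡ ⟩
      parent vᵢ     ≡⟨ parent-vᵢ ⟩
      u             ≡⟨ sym (fixRoot-root φ) ⟩
      fixRoot φ u   ≡⟨ cong (fixRoot φ) (sym p≡u) ⟩
      fixRoot φ (parent v) ∎
      where open ≡-Reasoning
    ... | inj₂ p∈S =
      trans (step v∈S p∈S (descend k (parent v) p∈S (≤-pred (subst (_≤ suc k) (depth-parent v (S⇒≢root v∈S)) d≤))))
            (sym (fixRoot-S φ p∈S))

  adjAut⇒commutes : ∀ {φ} → IsRootedAut S Adj vᵢ φ → CommutesWithParent φ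
  adjAut⇒commutes {φ} (φ-aut , φvᵢ≡) = commutes-by-descent φvᵢ≡ step
    where
    step : ∀ {v} → S v → S (parent v) → parent (φ (parent v)) ≡ fixRoot φ (parent (parent v)) →
           parent (φ v) ≡ φ (parent v)
    step {v} v∈S p∈S p-comm with adj⇒parent (aut-adj φ-aut v∈S p∈S (parent-adj v (S⇒≢root v∈S)))
    ... | inj₁ eq = eq
    ... | inj₂ eq = ⊥-elim (parent-not-swapped φ-aut v∈S p∈S p-comm eq)

  module _ {φ : Fin n → Fin n} (φ-aut : IsAut S AdjOrSiblings φ) (φvᵢ≡ : φ vᵢ ≡ vᵢ) where

    -- a sibling of φ p is a child of φ g, so v would be adjacent to or a sibling of its grandparent g
    siblings-not-created : ∀ {v} → S v → S (parent v) →
      parent (φ (parent v)) ≡ fixRoot φ (parent (parent v)) → ¬ φ v ≡ φ (parent v) →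
      ¬ parent (φ v) ≡ parent (φ (parent v))
    siblings-not-created {v} v∈S p∈S p-comm φv≢φp eq with parent-S⁺ p∈S
    ... | inj₁ pp≡u = φv≢φp (trans φv≡vᵢ (sym (trans (cong φ (parent≡root⇒vᵢ p∈S pp≡u)) φvᵢ≡)))
      where
      φv≡vᵢ : φ v ≡ vᵢ
      φv≡vᵢ = parent≡root⇒vᵢ (aut-P φ-aut v∈S)
                (trans eq (trans p-comm (trans (cong (fixRoot φ) pp≡u) (fixRoot-root φ))))
    ... | inj₂ g∈S with aut-adj⁻ φ-aut v∈S g∈S (φv≢φg , inj₁ (trans eq (trans p-comm (fixRoot-S φ g∈S))))
      where
      φv≢φg : ¬ φ v ≡ φ (parent (parent v))
      φv≢φg φv≡φg = parent²≢ (S⇒≢root v∈S) (S⇒≢root p∈S) (sym (aut-injective φ-aut v∈S g∈S φv≡φg))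
    ...   | _ , inj₁ pv≡g = parent-≢ (parent v) (S⇒≢root p∈S) pv≡g
    ...   | _ , inj₂ (inj₁ pg≡v) = parent³≢ (S⇒≢root v∈S) (S⇒≢root p∈S) (S⇒≢root g∈S) pg≡v
    ...   | _ , inj₂ (inj₂ pv≡pg) = parent²≢ (S⇒≢root p∈S) (S⇒≢root g∈S) (sym pv≡pg)

    adjOrSiblingsAut⇒commutes : CommutesWithParent φ
    adjOrSiblingsAut⇒commutes = commutes-by-descent φvᵢ≡ step
      where
      step : ∀ {v} → S v → S (parent v) → parent (φ (parent v)) ≡ fixRoot φ (parent (parent v)) →
             parent (φ v) ≡ φ (parent v)
      step {v} v∈S p∈S p-comm with aut-adj φ-aut v∈S p∈S (parent-≢ v (S⇒≢root v∈S) , inj₁ refl)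
      ... | _ , inj₁ eq = eq
      ... | _ , inj₂ (inj₁ eq) = ⊥-elim (parent-not-swapped φ-aut v∈S p∈S p-comm eq)
      ... | φv≢φp , inj₂ (inj₂ eq) = ⊥-elim (siblings-not-created v∈S p∈S p-comm φv≢φp eq)

  module Commuting {R : Fin n → Fin n → Set} {φ : Fin n → Fin n} (φ-aut : IsAut S R φ)
                   (comm : CommutesWithParent φ) where

    parent-to : ∀ {x y} → S x → S y → parent x ≡ y → parent (φ x) ≡ φ y
    parent-to {x} x∈S y∈S eq = trans (comm x x∈S) (trans (cong (fixRoot φ) eq) (fixRoot-S φ y∈S))

    parent-from : ∀ {x y} → S x → S y → parent (φ x) ≡ φ y → parent x ≡ y
    parent-from {x} x∈S y∈S eq =
      fixRoot-injective φ-aut (parent-S⁺ x∈S) (inj₂ y∈S) (trans (sym (comm x x∈S)) (trans eq (sym (fixRoot-S φ y∈S))))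

    siblings-to : ∀ {x y} → S x → S y → parent x ≡ parent y → parent (φ x) ≡ parent (φ y)
    siblings-to {x} {y} x∈S y∈S eq = trans (comm x x∈S) (trans (cong (fixRoot φ) eq) (sym (comm y y∈S)))

    siblings-from : ∀ {x y} → S x → S y → parent (φ x) ≡ parent (φ y) → parent x ≡ parent y
    siblings-from {x} {y} x∈S y∈S eq =
      fixRoot-injective φ-aut (parent-S⁺ x∈S) (parent-S⁺ y∈S) (trans (sym (comm x x∈S)) (trans eq (comm y y∈S)))

    adj-preserved : ∀ x y → S x → S y → (Adj x y → Adj (φ x) (φ y)) × (Adj (φ x) (φ y) → Adj x y)
    adj-preserved x y x∈S y∈S =
      (λ x~y → parent⇒adj (S⇒≢root (aut-P φ-aut x∈S)) (S⇒≢root (aut-P φ-aut y∈S))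
                 (⊎-map (parent-to x∈S y∈S) (parent-to y∈S x∈S) (adj⇒parent x~y))) ,
      (λ φx~φy → parent⇒adj (S⇒≢root x∈S) (S⇒≢root y∈S)
                   (⊎-map (parent-from x∈S y∈S) (parent-from y∈S x∈S) (adj⇒parent φx~φy)))

    adjOrSiblings-preserved : ∀ x y → S x → S y →
      (AdjOrSiblings x y → AdjOrSiblings (φ x) (φ y)) × (AdjOrSiblings (φ x) (φ y) → AdjOrSiblings x y)
    adjOrSiblings-preserved x y x∈S y∈S =
      (λ (x≢y , rel) → x≢y ∘ aut-injective φ-aut x∈S y∈S ,
         ⊎-map (parent-to x∈S y∈S) (⊎-map (parent-to y∈S x∈S) (siblings-to x∈S y∈S)) rel) ,
      (λ (φx≢φy , rel) → φx≢φy ∘ cong φ ,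
         ⊎-map (parent-from x∈S y∈S) (⊎-map (parent-from y∈S x∈S) (siblings-from x∈S y∈S)) rel)

  adjAut⇒adjOrSiblingsAut : ∀ {φ} → IsRootedAut S Adj vᵢ φ → IsRootedAut S AdjOrSiblings vᵢ φ
  adjAut⇒adjOrSiblingsAut φ-raut@(φ-aut , φvᵢ≡) =
    replace-relation φ-aut (Commuting.adjOrSiblings-preserved φ-aut (adjAut⇒commutes φ-raut)) , φvᵢ≡

  adjOrSiblingsAut⇒adjAut : ∀ {φ} → IsRootedAut S AdjOrSiblings vᵢ φ → IsRootedAut S Adj vᵢ φ
  adjOrSiblingsAut⇒adjAut (φ-aut , φvᵢ≡) =
    replace-relation φ-aut (Commuting.adj-preserved φ-aut (adjOrSiblingsAut⇒commutes φ-aut φvᵢ≡)) , φvᵢ≡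

  upEdge-bijection : PredBijection S S′
  upEdge-bijection = record
    { to = upEdge ; from = deeperEnd ; to-P = upEdge-S′ ; from-P = proj₁ ∘ S′⇒upEdge
    ; from-to = deeperEnd-upEdge ∘ S⇒≢root ; to-from = proj₂ ∘ S′⇒upEdge }

  EndsAdjOrSiblings : Edge → Edge → Set
  EndsAdjOrSiblings a b = AdjOrSiblings (deeperEnd a) (deeperEnd b)

  lineAdj⇔endsAdjOrSiblings : ∀ a b → S′ a → S′ b →
    (LAdj a b → EndsAdjOrSiblings a b) × (EndsAdjOrSiblings a b → LAdj a b)
  lineAdj⇔endsAdjOrSiblings a b a∈ b∈ =
    (λ ladj → lineAdj⇒adjOrSiblings (subst₂ LAdj (sym (proj₂ (S′⇒upEdge a∈))) (sym (proj₂ (S′⇒upEdge b∈))) ladj)) ,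
    (λ rel → subst₂ LAdj (proj₂ (S′⇒upEdge a∈)) (proj₂ (S′⇒upEdge b∈))
               (adjOrSiblings⇒lineAdj (S⇒≢root (proj₁ (S′⇒upEdge a∈))) (S⇒≢root (proj₁ (S′⇒upEdge b∈))) rel))

  lineAut-from-vertexAut : ∀ {φ} → IsRootedAut S Adj vᵢ φ → IsRootedAut S′ LAdj (upEdge vᵢ) (upEdge ∘ φ ∘ deeperEnd)
  lineAut-from-vertexAut {φ} φ-raut =
    aut-resp {R = EndsAdjOrSiblings} (proj₁ conj) (λ a b a∈ b∈ → swap (lineAdj⇔endsAdjOrSiblings a b a∈ b∈)) , proj₂ conj
    where
    conj : IsRootedAut S′ EndsAdjOrSiblings (upEdge vᵢ) (upEdge ∘ φ ∘ deeperEnd)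
    conj = conjugate-aut upEdge-bijection {R = AdjOrSiblings} vᵢ∈S (adjAut⇒adjOrSiblingsAut φ-raut)

  vertexAut-from-lineAut : ∀ {Ψ} → IsRootedAut S′ LAdj (upEdge vᵢ) Ψ → IsRootedAut S Adj vᵢ (deeperEnd ∘ Ψ ∘ upEdge)
  vertexAut-from-lineAut {Ψ} (Ψ-aut , Ψ-fix) =
    adjOrSiblingsAut⇒adjAut (aut-resp (proj₁ conj) cancel , subst (λ r → deeperEnd (Ψ (upEdge r)) ≡ r) vᵢ≡ (proj₂ conj))
    where
    conj : IsRootedAut S (λ x y → EndsAdjOrSiblings (upEdge x) (upEdge y)) (deeperEnd (upEdge vᵢ)) (deeperEnd ∘ Ψ ∘ upEdge)
    conj = conjugate-aut (PredBijection.inverse upEdge-bijection) {R = EndsAdjOrSiblings} (upEdge-S′ vᵢ∈S)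
             (aut-resp Ψ-aut lineAdj⇔endsAdjOrSiblings , Ψ-fix)
    vᵢ≡ : deeperEnd (upEdge vᵢ) ≡ vᵢ
    vᵢ≡ = deeperEnd-upEdge (S⇒≢root vᵢ∈S)
    cancel : ∀ x y → S x → S y → (EndsAdjOrSiblings (upEdge x) (upEdge y) → AdjOrSiblings x y) ×
                                 (AdjOrSiblings x y → EndsAdjOrSiblings (upEdge x) (upEdge y))
    cancel x y x∈ y∈ = subst₂ AdjOrSiblings (deeperEnd-upEdge (S⇒≢root x∈)) (deeperEnd-upEdge (S⇒≢root y∈)) ,
                       subst₂ AdjOrSiblings (sym (deeperEnd-upEdge (S⇒≢root x∈))) (sym (deeperEnd-upEdge (S⇒≢root y∈)))

lemma11 : (n : ℕ) (adj : Fin n → Fin n → Bool) → Graph.IsTree adj →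
    (s : Fin n) → ¬ Graph.InCenter adj s →
    (vᵢ u : Fin n) → Graph.InComp adj s vᵢ → Graph.InCenter adj u → Graph.Adj adj vᵢ u →
    (e : Graph.Edge adj) → Graph.IsEv adj vᵢ e →
    (k : ℕ) → 0 < k →
    SameNumberOfClasses
      (DistColoring (Graph.InComp adj s) (Graph.Adj adj) vᵢ k)
      (EquivCol (Graph.InComp adj s) (Graph.Adj adj) vᵢ k)
      (DistColoring (Graph.InComp' adj s) (Graph.LAdj adj) e k)
      (EquivCol (Graph.InComp' adj s) (Graph.LAdj adj) e k)
lemma11 n adj T s _ vᵢ u vᵢ∈S u-center vᵢ~u e e-isEv k _ =
  subst (λ r → SameNumberOfClasses (DistColoring S Adj vᵢ k) (EquivCol S Adj vᵢ k)
                                   (DistColoring S′ LAdj r k) (EquivCol S′ LAdj r k))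
        (sym (isEv⇒upEdge vᵢ∈S e-isEv))
        (transport-classes upEdge-bijection k lineAut-from-vertexAut vertexAut-from-lineAut)
  where
  open Graph adj
  open Branch adj T s vᵢ u vᵢ∈S u-center vᵢ~u
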